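{- Let $j$ be a nonnegative integer, $m$ a positive integer, and $\ell=\lceil\log_2(m+j)\rceil$. If $\mathfrak{K}_j(m)>2^\ell+1$, then $\mathbf{t}_{m+1}\mathbf{t}_{m+2}=11$ and $\mathbf{t}_{2m+1}\mathbf{t}_{2m+2}=10$.
   Context: The Thue–Morse word $\mathbf{t}=\mathbf{t}_1\mathbf{t}_2\mathbf{t}_3\cdots=0110100110010110\cdots$ is the infinite binary word whose $i$-th letter $\mathbf{t}_i$ ($i\ge 1$) is the parity of the number of 1's in the binary expansion of $i-1$. A $k$-anti-power is a word $w^{(1)}\cdots w^{(k)}$ with $w^{(1)},\dots,w^{(k)}$ pairwise distinct words of the same length. For $j\ge0$, the $j$-fix of $\mathbf{t}$ of length $N$ is $\mathbf{t}_{j+1}\cdots\mathbf{t}_{j+N}$. For a positive integer $m$, $\mathfrak{K}_j(m)$ is the smallest positive integer $k$ such that the $j$-fix of $\mathbf{t}$ of length $km$ is not a $k$-anti-power. -}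

module Defs where

open import Data.Nat using (ℕ; zero; suc; _+_; _*_; _≤_; _<_)
open import Data.Nat.Base using (⌊_/2⌋; _%_)
open import Data.Bool using (Bool; true; false; _xor_)
open import Data.Product using (_×_)
open import Relation.Nullary using (¬_)
open import Relation.Binary.PropositionalEquality using (_≡_)

-- parity (as a Bool, true = odd) of the number of 1's in the binary
-- expansion of n, computed with fuel f (f ≥ n suffices, since each step halves)
bitParityAux : ℕ → ℕ → Bool
bitParityAux zero    n = false
bitParityAux (suc f) zero = false
bitParityAux (suc f) (suc n) = (((suc n) % 2) ≡ᵇ1) xor bitParityAux f ⌊ suc n /2⌋
  where
  _≡ᵇ1 : ℕ → Bool
  1 ≡ᵇ1 = true
  _ ≡ᵇ1 = false

bitParity : ℕ → Bool
bitParity n = bitParityAux n n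

-- Thue–Morse word, 1-indexed: t i = parity of the number of 1's in binary of i-1
-- (false = letter 0, true = letter 1). t 0 is a dummy value, never used.
t : ℕ → Bool
t zero    = false
t (suc i) = bitParity i

SameBlock : (j m r s : ℕ) → Set
SameBlock j m r s = ∀ p → 1 ≤ p → p ≤ m → t (j + (r * m) + p) ≡ t (j + (s * m) + p)
-- NB: here blocks are indexed by r = 0 .. k-1 (block r occupies positions
-- j + r m + 1 .. j + r m + m of t).

IsAntiPower : (j m k : ℕ) → Set
IsAntiPower j m k = ∀ r s → r < k → s < k → r ≢ s → ¬ SameBlock j m r s
  where
  _≢_ : ℕ → ℕ → Set
  a ≢ b = ¬ (a ≡ b)

IsKfrak : (j m K : ℕ) → Set
IsKfrak j m K = (1 ≤ K) × (¬ IsAntiPower j m K) × (∀ k → 1 ≤ k → k < K → IsAntiPower j m k)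

-- Write tm n = t_{n+1} for the 0-indexed Thue–Morse word and L = 2^ℓ.  The
-- proof rests on the concatenation law
--     tm (n + a·2^e) = tm n xor tm a        for n < 2^e,
-- obtained from the recurrences tm (2k) = tm k, tm (2k+1) = not (tm k).  It
-- says that the window of length 2^e starting at a·2^e is determined by tm a,
-- and the window of length 2^(e+1) starting there by (tm a, tm (a+1)).
-- Since m + j ≤ L, two blocks r, s of the j-fix are equal as soon as the
-- windows of length L at offsets r·m and s·m agree.  The hypothesis says the
-- blocks 0, 1, …, L are pairwise distinct, and we compare two pairs of them:
--   * blocks 0 and L  (offsets 0·L and m·L):   distinct only if tm m = true;
--   * blocks L/2 and L (offsets m·2^e and 2m·2^e, where L = 2^(e+1)):
--     distinct only if tm (m+1) ≠ tm (2m+1) = not (tm m), i.e. tm (m+1) = true.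
-- The four letters of the theorem are tm m, tm (m+1), tm (2m) = tm m and
-- tm (2m+1) = not (tm m).
module Submission where

open import Defs
open import Agda.Builtin.Nat using (mod-helper)
open import Data.Nat.Base
open import Data.Nat.Properties
open import Data.Nat.Logarithm using (⌈log₂_⌉)
open import Data.Nat.Logarithm.Core using (⌈log2⌉)
open import Data.Nat.Induction using (<-wellFounded)
open import Data.Nat.Tactic.RingSolver using (solve-∀)
open import Induction.WellFounded using (Acc; acc)
open import Data.Bool using (Bool; true; false; not; _xor_)
open import Data.Bool.Properties using (xor-assoc)
open import Data.Empty using (⊥-elim)
open import Data.Product using (Σ; _,_; _×_)
open import Data.Sum using (_⊎_; inj₁; inj₂)
open import Relation.Nullary using (¬_; yes; no)
open import Relation.Binary.PropositionalEquality
  using (_≡_; refl; sym; trans; cong; subst; subst₂; module ≡-Reasoning)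

tm : ℕ → Bool
tm = bitParity

half≤ : ∀ n → ⌊ suc n /2⌋ ≤ n
half≤ n = ≤-pred (⌊n/2⌋<n n)

-- The fuel of bitParityAux is irrelevant once it bounds the argument
-- (the parity bit suc n % 2 computes to mod-helper 1 1 n 0).
bitParityAux-fuel : ∀ f g n → n ≤ f → n ≤ g → bitParityAux f n ≡ bitParityAux g n
bitParityAux-fuel zero    zero    zero    _       _       = refl
bitParityAux-fuel zero    (suc g) zero    _       _       = refl
bitParityAux-fuel (suc f) zero    zero    _       _       = refl
bitParityAux-fuel (suc f) (suc g) zero    _       _       = refl
bitParityAux-fuel (suc f) (suc g) (suc n) (s≤s n≤f) (s≤s n≤g)
  with mod-helper 1 1 n 0
     | bitParityAux-fuel f g ⌊ suc n /2⌋ (≤-trans (half≤ n) n≤f) (≤-trans (half≤ n) n≤g)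
... | zero        | same = same
... | suc zero    | same = cong not same
... | suc (suc _) | same = same

tm-unfold-even : ∀ n → suc n % 2 ≡ 0 → tm (suc n) ≡ tm ⌊ suc n /2⌋
tm-unfold-even n even rewrite even =
  bitParityAux-fuel n ⌊ suc n /2⌋ ⌊ suc n /2⌋ (half≤ n) ≤-refl

tm-unfold-odd : ∀ n → suc n % 2 ≡ 1 → tm (suc n) ≡ not (tm ⌊ suc n /2⌋)
tm-unfold-odd n odd rewrite odd =
  cong not (bitParityAux-fuel n ⌊ suc n /2⌋ ⌊ suc n /2⌋ (half≤ n) ≤-refl)

double-even : ∀ k → (k + k) % 2 ≡ 0
double-even zero    = refl
double-even (suc k) = trans (cong (λ x → suc x % 2) (+-suc k k)) (double-even k)

double-odd : ∀ k → suc (k + k) % 2 ≡ 1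
double-odd zero    = refl
double-odd (suc k) = trans (cong (λ x → suc (suc x) % 2) (+-suc k k)) (double-odd k)

tm-double : ∀ k → tm (k + k) ≡ tm k
tm-double zero    = refl
tm-double (suc k) = begin
  tm (suc k + suc k)             ≡⟨ tm-unfold-even (k + suc k) (double-even (suc k)) ⟩
  tm ⌊ suc k + suc k /2⌋         ≡⟨ cong tm (sym (n≡⌊n+n/2⌋ (suc k))) ⟩
  tm (suc k)                     ∎
  where open ≡-Reasoning

tm-double-suc : ∀ k → tm (suc (k + k)) ≡ not (tm k)
tm-double-suc k = begin
  tm (suc (k + k))               ≡⟨ tm-unfold-odd (k + k) (double-odd k) ⟩
  not (tm ⌈ k + k /2⌉)           ≡⟨ cong (λ x → not (tm x)) (sym (n≡⌈n+n/2⌉ k)) ⟩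
  not (tm k)                     ∎
  where open ≡-Reasoning

double : ∀ h → 2 * h ≡ h + h
double = solve-∀

split-halves : ∀ h n → n < h + h → n < h ⊎ Σ ℕ (λ d → d < h × n ≡ h + d)
split-halves h n n<2h with n <? h
... | yes n<h = inj₁ n<h
... | no  n≮h = inj₂ (n ∸ h , +-cancelˡ-< h (n ∸ h) h h+d<h+h , sym h+d≡n)
  where
  h+d≡n : h + (n ∸ h) ≡ n
  h+d≡n = m+[n∸m]≡n (≮⇒≥ n≮h)
  h+d<h+h : h + (n ∸ h) < h + h
  h+d<h+h = subst₂ _<_ (sym h+d≡n) refl n<2h

-- tm (n + a·2^e) = tm n xor tm a for n < 2^e: the binary expansion of
-- n + a·2^e is that of a followed by that of n.
tm-concat : ∀ e n a → n < 2 ^ e → tm (n + a * 2 ^ e) ≡ tm n xor tm a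
tm-concat zero zero    a _         = cong tm (*-identityʳ a)
tm-concat zero (suc n) a (s≤s ())
tm-concat (suc e) n a n<2^[e+1] with split-halves (2 ^ e) n (subst₂ _<_ refl (double (2 ^ e)) n<2^[e+1])
... | inj₁ n<h = begin
  tm (n + a * (2 * 2 ^ e))       ≡⟨ cong tm (lower-half n a (2 ^ e)) ⟩
  tm (n + (a + a) * 2 ^ e)       ≡⟨ tm-concat e n (a + a) n<h ⟩
  tm n xor tm (a + a)            ≡⟨ cong (tm n xor_) (tm-double a) ⟩
  tm n xor tm a                  ∎
  where
  open ≡-Reasoning
  lower-half : ∀ n a h → n + a * (2 * h) ≡ n + (a + a) * h
  lower-half = solve-∀
... | inj₂ (d , d<h , refl) = begin
  tm ((h + d) + a * (2 * h))     ≡⟨ cong tm (upper-half d a h) ⟩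
  tm (d + suc (a + a) * h)       ≡⟨ tm-concat e d (suc (a + a)) d<h ⟩
  tm d xor tm (suc (a + a))      ≡⟨ cong (tm d xor_) (tm-double-suc a) ⟩
  tm d xor not (tm a)            ≡⟨ sym (xor-assoc (tm d) true (tm a)) ⟩
  (tm d xor true) xor tm a       ≡⟨ cong (_xor tm a) (sym (tm-concat e d 1 d<h)) ⟩
  tm (d + 1 * h) xor tm a        ≡⟨ cong (λ x → tm x xor tm a) (leading-bit d h) ⟩
  tm (h + d) xor tm a            ∎
  where
  open ≡-Reasoning
  h : ℕ
  h = 2 ^ e
  upper-half : ∀ d a h → (h + d) + a * (2 * h) ≡ d + suc (a + a) * h
  upper-half = solve-∀
  leading-bit : ∀ d h → d + 1 * h ≡ h + d
  leading-bit = solve-∀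

WindowsAgree : (w a b : ℕ) → Set
WindowsAgree w a b = ∀ n → n < w → tm (n + a) ≡ tm (n + b)

windows-agree : ∀ e c c' → tm c ≡ tm c' → WindowsAgree (2 ^ e) (c * 2 ^ e) (c' * 2 ^ e)
windows-agree e c c' same n n<2^e = begin
  tm (n + c * 2 ^ e)             ≡⟨ tm-concat e n c n<2^e ⟩
  tm n xor tm c                  ≡⟨ cong (tm n xor_) same ⟩
  tm n xor tm c'                 ≡⟨ sym (tm-concat e n c' n<2^e) ⟩
  tm (n + c' * 2 ^ e)            ∎
  where open ≡-Reasoning

-- The window of length 2^(e+1) at offset c·2^e is determined by tm c and
-- tm (c+1): its upper half is the window of length 2^e at offset (c+1)·2^e.
double-windows-agree : ∀ e c c' → tm c ≡ tm c' → tm (suc c) ≡ tm (suc c') →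
                       WindowsAgree (2 ^ suc e) (c * 2 ^ e) (c' * 2 ^ e)
double-windows-agree e c c' same same-suc n n<2^[e+1]
  with split-halves (2 ^ e) n (subst₂ _<_ refl (double (2 ^ e)) n<2^[e+1])
... | inj₁ n<h = windows-agree e c c' same n n<h
... | inj₂ (d , d<h , refl) = begin
  tm ((h + d) + c * h)           ≡⟨ cong tm (shift d c h) ⟩
  tm (d + suc c * h)             ≡⟨ windows-agree e (suc c) (suc c') same-suc d d<h ⟩
  tm (d + suc c' * h)            ≡⟨ cong tm (sym (shift d c' h)) ⟩
  tm ((h + d) + c' * h)          ∎
  where
  open ≡-Reasoning
  h : ℕ
  h = 2 ^ e
  shift : ∀ d c h → (h + d) + c * h ≡ d + suc c * h
  shift = solve-∀

-- Block r of the j-fix consists of the letters tm (j + p + r·m), p < m, and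
-- j + p < m + j; so agreeing windows of length ≥ m + j give equal blocks.
sameBlock-from-windows : ∀ j m w r s → m + j ≤ w → WindowsAgree w (r * m) (s * m) →
                         SameBlock j m r s
sameBlock-from-windows j m w r s m+j≤w agree (suc p) _ p<m = begin
  t (j + r * m + suc p)          ≡⟨ cong t (letter-index j r m p) ⟩
  tm (j + p + r * m)             ≡⟨ agree (j + p) j+p<w ⟩
  tm (j + p + s * m)             ≡⟨ cong t (sym (letter-index j s m p)) ⟩
  t (j + s * m + suc p)          ∎
  where
  open ≡-Reasoning
  letter-index : ∀ j r m p → j + r * m + suc p ≡ suc (j + p + r * m)
  letter-index = solve-∀
  j+p<w : j + p < w
  j+p<w = ≤-trans (subst₂ _≤_ (+-suc j p) (+-comm j m) (+-monoʳ-≤ j p<m)) m+j≤w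

antiPower-windows-differ : ∀ j m k w r s → IsAntiPower j m k → m + j ≤ w →
                           r < k → s < k → ¬ r ≡ s → ¬ WindowsAgree w (r * m) (s * m)
antiPower-windows-differ j m k w r s antiPower m+j≤w r<k s<k r≢s agree =
  antiPower r s r<k s<k r≢s (sameBlock-from-windows j m w r s m+j≤w agree)

≤2^⌈log2⌉ : ∀ n (accessible : Acc _<_ n) → n ≤ 2 ^ ⌈log2⌉ n accessible
≤2^⌈log2⌉ zero          _        = z≤n
≤2^⌈log2⌉ (suc zero)    _        = ≤-refl
≤2^⌈log2⌉ (suc (suc n)) (acc rs) = begin
  2 + n                          ≤⟨ +-monoʳ-≤ 2 n≤2⌈n/2⌉ ⟩
  2 + (⌈ n /2⌉ + ⌈ n /2⌉)        ≡⟨ double-suc ⌈ n /2⌉ ⟩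
  2 * suc ⌈ n /2⌉                ≤⟨ *-monoʳ-≤ 2 (≤2^⌈log2⌉ (suc ⌈ n /2⌉) (rs (⌈n/2⌉<n n))) ⟩
  2 * 2 ^ ⌈log2⌉ (suc ⌈ n /2⌉) (rs (⌈n/2⌉<n n)) ∎
  where
  open ≤-Reasoning
  double-suc : ∀ c → 2 + (c + c) ≡ 2 * suc c
  double-suc = solve-∀
  n≤2⌈n/2⌉ : n ≤ ⌈ n /2⌉ + ⌈ n /2⌉
  n≤2⌈n/2⌉ = subst₂ _≤_ (⌊n/2⌋+⌈n/2⌉≡n n) refl (+-monoˡ-≤ ⌈ n /2⌉ (⌊n/2⌋≤⌈n/2⌉ n))

≤2^⌈log₂⌉ : ∀ n → n ≤ 2 ^ ⌈log₂ n ⌉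
≤2^⌈log₂⌉ n = ≤2^⌈log2⌉ n (<-wellFounded n)

module LeadingLetters (j m : ℕ) where

  blocks-differ : ∀ ℓ → m + j ≤ 2 ^ ℓ → IsAntiPower j m (2 ^ ℓ + 1) →
                  ∀ r s → r ≤ 2 ^ ℓ → s ≤ 2 ^ ℓ → ¬ r ≡ s →
                  ¬ WindowsAgree (2 ^ ℓ) (r * m) (s * m)
  blocks-differ ℓ m+j≤L antiPower r s r≤L s≤L =
    antiPower-windows-differ j m (2 ^ ℓ + 1) (2 ^ ℓ) r s antiPower m+j≤L (≤⇒<+1 r≤L) (≤⇒<+1 s≤L)
    where
    ≤⇒<+1 : ∀ {x} → x ≤ 2 ^ ℓ → x < 2 ^ ℓ + 1
    ≤⇒<+1 x≤L = subst₂ _<_ refl (+-comm 1 (2 ^ ℓ)) (s≤s x≤L)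

  -- Blocks 0 and L have agreeing windows (at offsets 0·L and m·L) unless tm m = true.
  tm-m : ∀ ℓ → m + j ≤ 2 ^ ℓ → IsAntiPower j m (2 ^ ℓ + 1) → tm m ≡ true
  tm-m ℓ m+j≤L antiPower with tm m in tm-m≡
  ... | true  = refl
  ... | false = ⊥-elim (blocks-differ ℓ m+j≤L antiPower 0 (2 ^ ℓ) z≤n ≤-refl (<⇒≢ (m^n>0 2 ℓ))
                  (subst₂ (WindowsAgree (2 ^ ℓ)) refl (*-comm m (2 ^ ℓ))
                    (windows-agree ℓ 0 m (sym tm-m≡))))

  -- For L = 2h, blocks h and L (offsets m·h and 2m·h) have agreeing windows
  -- unless tm (m+1) ≠ tm (2m+1) = not (tm m) = false.  For L = 1, m = 1.
  tm-suc-m : ∀ ℓ → 1 ≤ m → m + j ≤ 2 ^ ℓ → IsAntiPower j m (2 ^ ℓ + 1) →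
             tm m ≡ true → tm (suc m) ≡ true
  tm-suc-m zero 1≤m m+j≤1 _ _ = subst (λ x → tm (suc x) ≡ true) (sym m≡1) refl
    where
    m≡1 : m ≡ 1
    m≡1 = ≤-antisym (≤-trans (m≤m+n m j) m+j≤1) 1≤m
  tm-suc-m (suc e) _ m+j≤L antiPower tm-m≡true with tm (suc m) in tm-suc-m≡
  ... | true  = refl
  ... | false = ⊥-elim (blocks-differ (suc e) m+j≤L antiPower h (2 ^ suc e) (<⇒≤ h<2h) ≤-refl (<⇒≢ h<2h)
                  (subst₂ (WindowsAgree (2 ^ suc e)) (*-comm m h) (double-offset m h)
                    (double-windows-agree e m (m + m) (sym (tm-double m)) same-suc)))
    where
    h : ℕ
    h = 2 ^ e
    h<2h : h < 2 ^ suc e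
    h<2h = subst₂ _<_ refl (sym (double h)) (m<m+n h (m^n>0 2 e))
    double-offset : ∀ m h → (m + m) * h ≡ (2 * h) * m
    double-offset = solve-∀
    same-suc : tm (suc m) ≡ tm (suc (m + m))
    same-suc = trans tm-suc-m≡ (sym (trans (tm-double-suc m) (cong not tm-m≡true)))

mainTheorem9 : (j m K : ℕ) → 1 ≤ m → IsKfrak j m K →
               2 ^ ⌈log₂ (m + j) ⌉ + 1 < K →
               (t (m + 1) ≡ true × t (m + 2) ≡ true) ×
               (t (2 * m + 1) ≡ true × t (2 * m + 2) ≡ false)
mainTheorem9 j m K 1≤m (_ , _ , antiPowerBelowK) L+1<K =
  (trans (cong t (+-comm m 1)) tm-m≡true , trans (cong t (+-comm m 2)) tm-suc-m≡true) ,
  (trans (cong t (index-2m m)) (trans (tm-double m) tm-m≡true) ,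
   trans (cong t (index-2m+1 m)) (trans (tm-double-suc m) (cong not tm-m≡true)))
  where
  open LeadingLetters j m
  ℓ : ℕ
  ℓ = ⌈log₂ (m + j) ⌉
  antiPower : IsAntiPower j m (2 ^ ℓ + 1)
  antiPower = antiPowerBelowK (2 ^ ℓ + 1) (m≤n+m 1 (2 ^ ℓ)) L+1<K
  tm-m≡true : tm m ≡ true
  tm-m≡true = tm-m ℓ (≤2^⌈log₂⌉ (m + j)) antiPower
  tm-suc-m≡true : tm (suc m) ≡ true
  tm-suc-m≡true = tm-suc-m ℓ 1≤m (≤2^⌈log₂⌉ (m + j)) antiPower tm-m≡true
  index-2m : ∀ m → 2 * m + 1 ≡ suc (m + m)
  index-2m = solve-∀
  index-2m+1 : ∀ m → 2 * m + 2 ≡ suc (suc (m + m))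
  index-2m+1 = solve-∀
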